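{- Let $\sigma=\sum_{k\ge0}a_kt^k\in\mathbb{F}_2[[t]]$. The following are equivalent: (1) $\sigma\in\hat S$; (2) there is an integer $m\ge1$ such that $(t^m+1)\sigma$ is sparse; (3) there is an integer $m\ge1$ such that $\sum_{k\ge0}(a_k+a_{k+m})t^k$ is sparse; (4) there is an integer $m\ge1$ such that for all integers $q\ge0$ the series $\sum_{k\ge0}(a_k+a_{k+2^qm})t^k$ is sparse.
   Context: For $\tau=\sum b_kt^k\in\mathbb{F}_2[[t]]$, $E(\tau)=\{k:b_k=1\}$, and $\tau$ is sparse if $\#(E(\tau)\cap\{0,\dots,N\})=O((\log N)^r)$ for some $r\ge0$. Let $S$ be the set of sparse series (an $\mathbb{F}_2[t]$-algebra), and $\hat S$ the set of power series in $\mathbb{F}_2[[t]]$ that can be written as a product of a sparse series and a rational function in $\mathbb{F}_2(t)$. -}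

module Defs where

open import Data.Bool using (Bool; true; false; _xor_; _∧_; if_then_else_)
open import Data.Nat using (ℕ; zero; suc; _+_; _*_; _∸_; _^_; _≤_; _≤ᵇ_)
open import Data.Nat.Logarithm using (⌊log₂_⌋)
open import Data.List using (List; []; _∷_)
open import Data.List.Membership.Propositional using (_∈_)
open import Data.Product using (Σ; ∃; _×_)
open import Relation.Binary.PropositionalEquality using (_≡_)

-- A formal power series over F₂: σ k = true iff the coefficient of t^k is 1.
Series : Set
Series = ℕ → Bool

count : Series → ℕ → ℕ
count σ zero    = if σ zero then 1 else 0
count σ (suc N) = count σ N + (if σ (suc N) then 1 else 0)

-- σ is sparse: #(E(σ) ∩ {0..N}) = O((log N)^r) for some r ≥ 0.
-- Rendered with an explicit constant valid for all N and the log replaced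
-- by (⌊log₂ N⌋ + 1), which agrees with log N up to constant factors for N ≥ 2.
Sparse : Series → Set
Sparse σ = Σ ℕ λ r → Σ ℕ λ C → ∀ N → count σ N ≤ C * (suc ⌊log₂ N ⌋) ^ r

-- Polynomials in F₂[t] as coefficient lists (lowest degree first).
Poly : Set
Poly = List Bool

NonZeroPoly : Poly → Set
NonZeroPoly p = true ∈ p

-- product of a polynomial with a power series:  (b + t·p)·σ = b·σ + t·(p·σ)
_·_ : Poly → Series → Series
([]    · σ) n       = false
((b ∷ p) · σ) zero    = b ∧ σ zero
((b ∷ p) · σ) (suc n) = (b ∧ σ (suc n)) xor (p · σ) n

-- σ ∈ Ŝ : σ = τ · (p/q) for a sparse τ and a rational function p/q (q ≠ 0),
-- i.e. (in F₂((t))) q·σ = p·τ.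
InSHat : Series → Set
InSHat σ = Σ Series λ τ → Σ Poly λ p → Σ Poly λ q →
  Sparse τ × NonZeroPoly q × (∀ n → (q · σ) n ≡ (p · τ) n)

tm+1· : ℕ → Series → Series
tm+1· m σ n = σ n xor (if m ≤ᵇ n then σ (n ∸ m) else false)

diffSeries : ℕ → Series → Series
diffSeries m σ k = σ k xor σ (k + m)

-- Sparse series form an F₂[t]-module closed under shifts, finite modifications and
-- bounded spreading of supports.  This gives (2) ⇒ (1) and the equivalence of (2), (3)
-- and (4) directly, the last since a_k + a_{k+2m} = (a_k + a_{k+m}) + (a_{k+m} + a_{k+2m}).
-- For (1) ⇒ (2), clear denominators and leading powers of t to get a sparse
-- ρ = (1 + tq)σ.  Wherever ρ vanishes, σ obeys the recurrence σ_{n+1} = (qσ)_n, i.e. a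
-- map F on windows (σ_n, …, σ_{n-d}) of fixed length.  There are finitely many windows,
-- so F^a = F^b for some a < b; hence across every run of b zeros of ρ the series σ
-- repeats with period m = b - a, and each nonzero coefficient of (t^m + 1)σ lies less
-- than b places after a nonzero coefficient of ρ.
module Submission where

open import Defs
import Algebra.Properties.CommutativeSemigroup
open import Data.Bool using (Bool; true; false; _∧_; _∨_; _xor_; if_then_else_)
open import Data.Bool.Properties using (xor-identityʳ; xor-same; xor-assoc; xor-comm; ∧-zeroʳ)
open import Data.Empty using (⊥-elim)
open import Data.Fin using (toℕ)
open import Data.Fin.Properties using (pigeonhole)
open import Data.List using (List; []; _∷_; _++_; replicate; length; cartesianProductWith)
import Data.List as List
open import Data.List.Membership.Propositional using (_∈_)
open import Data.List.Membership.Propositional.Properties using (∈-cartesianProductWith⁺)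
open import Data.List.Relation.Unary.Any using (here; there; index)
open import Data.List.Relation.Unary.Any.Properties using (lookup-index)
open import Data.Nat using (ℕ; zero; suc; _+_; _*_; _∸_; _^_; _≤_; _<_; _≥_; _≤ᵇ_; z≤n; s≤s)
open import Data.Nat.GeneralisedArithmetic using (fold)
open import Data.Nat.Logarithm using (⌊log₂_⌋)
open import Data.Nat.Properties
open import Data.Product using (Σ; ∃₂; _×_; _,_; proj₁; proj₂)
open import Data.Sum using (inj₁; inj₂)
open import Data.Vec using (Vec; []; _∷_; head; tabulate)
import Data.Vec as Vec
open import Data.Vec.Properties using (lookup∘tabulate)
open import Function using (_∘_)
open import Function.Bundles using (_⇔_; mk⇔; Equivalence)
open import Function.Construct.Composition using (_⇔-∘_)
open import Relation.Binary.PropositionalEquality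
open import Relation.Nullary using (¬_)

open Algebra.Properties.CommutativeSemigroup +-commutativeSemigroup using (interchange)

private
  variable
    A : Set
    x y σ τ : Series

xor≡false⇒≡ : ∀ a b → a xor b ≡ false → a ≡ b
xor≡false⇒≡ false false _ = refl
xor≡false⇒≡ true  true  _ = refl

∨≡false⇒ : ∀ a b → a ∨ b ≡ false → a ≡ false × b ≡ false
∨≡false⇒ false false _ = refl , refl

xor-telescope : ∀ a b c → a xor c ≡ (a xor b) xor (b xor c)
xor-telescope a b c = begin
  a xor c                   ≡⟨ cong (a xor_) (cong (_xor c) (sym (xor-same b))) ⟩
  a xor ((b xor b) xor c)   ≡⟨ cong (a xor_) (xor-assoc b b c) ⟩
  a xor (b xor (b xor c))   ≡⟨ sym (xor-assoc a b (b xor c)) ⟩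
  (a xor b) xor (b xor c)   ∎
  where open ≡-Reasoning

-- Finite collections and collisions of iterates

vectors : List A → (n : ℕ) → List (Vec A n)
vectors xs zero    = [] ∷ []
vectors xs (suc n) = cartesianProductWith _∷_ xs (vectors xs n)

∈-vectors : {xs : List A} → (∀ a → a ∈ xs) → ∀ {n} (v : Vec A n) → v ∈ vectors xs n
∈-vectors enum []      = here refl
∈-vectors enum (a ∷ v) = ∈-cartesianProductWith⁺ _∷_ (enum a) (∈-vectors enum v)

∈-bools : ∀ b → b ∈ false ∷ true ∷ []
∈-bools false = here refl
∈-bools true  = there (here refl)

pigeonhole-ℕ : (xs : List A) → (∀ a → a ∈ xs) → (g : ℕ → A) →
               ∃₂ λ i j → i < j × g i ≡ g j
pigeonhole-ℕ xs enum g
  with i , j , i<j , same ← pigeonhole (n<1+n (length xs)) (index ∘ enum ∘ g ∘ toℕ)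
  = toℕ i , toℕ j , i<j , (begin
    g (toℕ i)                                  ≡⟨ lookup-index (enum (g (toℕ i))) ⟩
    List.lookup xs (index (enum (g (toℕ i))))  ≡⟨ cong (List.lookup xs) same ⟩
    List.lookup xs (index (enum (g (toℕ j))))  ≡⟨ lookup-index (enum (g (toℕ j))) ⟨
    g (toℕ j)                                  ∎)
  where open ≡-Reasoning

-- Two iterates agree everywhere because the vector of their values on an enumeration
-- ranges over a finite set.
module _ (xs : List A) (enum : ∀ a → a ∈ xs) (f : A → A) where

  private
    snapshot : ℕ → Vec A (length xs)
    snapshot k = tabulate (λ i → fold (List.lookup xs i) f k)

    element : A → A
    element a = List.lookup xs (index (enum a))

  fold-collision : ∃₂ λ i j → i < j × ∀ a → fold a f i ≡ fold a f j
  fold-collision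
    with i , j , i<j , same ← pigeonhole-ℕ (vectors xs (length xs)) (∈-vectors enum) snapshot
    = i , j , i<j , λ a → begin
      fold a f i                  ≡⟨ cong (λ c → fold c f i) (lookup-index (enum a)) ⟩
      fold (element a) f i        ≡⟨ lookup∘tabulate (λ k → fold (List.lookup xs k) f i) _ ⟨
      Vec.lookup (snapshot i) _   ≡⟨ cong (λ v → Vec.lookup v (index (enum a))) same ⟩
      Vec.lookup (snapshot j) _   ≡⟨ lookup∘tabulate (λ k → fold (List.lookup xs k) f j) _ ⟩
      fold (element a) f j        ≡⟨ cong (λ c → fold c f j) (lookup-index (enum a)) ⟨
      fold a f j                  ∎
    where open ≡-Reasoning

_⊆_ : Series → Series → Set
x ⊆ y = ∀ n → x n ≡ true → y n ≡ true

infixr 25 t·_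

t·_ : Series → Series
(t· σ) zero    = false
(t· σ) (suc n) = σ n

t·-cong : x ≗ y → t· x ≗ t· y
t·-cong e zero    = refl
t·-cong e (suc n) = e n

bit : Bool → ℕ
bit b = if b then 1 else 0

bit≤1 : ∀ b → bit b ≤ 1
bit≤1 false = z≤n
bit≤1 true  = ≤-refl

bit-∨ : ∀ a b → bit (a ∨ b) ≤ bit a + bit b
bit-∨ false b     = ≤-refl
bit-∨ true  false = ≤-refl
bit-∨ true  true  = s≤s z≤n

bit-⊆ : ∀ a b → (a ≡ true → b ≡ true) → bit a ≤ bit b
bit-⊆ false b     _ = z≤n
bit-⊆ true  b     h rewrite h refl = ≤-refl

count-suc : ∀ x N → count x (suc N) ≡ bit (x 0) + count (x ∘ suc) N
count-suc x zero    = refl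
count-suc x (suc N) =
  trans (cong (_+ bit (x (suc (suc N)))) (count-suc x N)) (+-assoc (bit (x 0)) _ _)

count-≤-count-suc : ∀ x N → count x N ≤ count x (suc N)
count-≤-count-suc x N = m≤m+n (count x N) _

count-⊆ : x ⊆ y → ∀ N → count x N ≤ count y N
count-⊆ {x} {y} h zero    = bit-⊆ (x 0) (y 0) (h 0)
count-⊆ {x} {y} h (suc N) = +-mono-≤ (count-⊆ h N) (bit-⊆ (x (suc N)) (y (suc N)) (h (suc N)))

count-∨ : ∀ x y N → count (λ n → x n ∨ y n) N ≤ count x N + count y N
count-∨ x y zero    = bit-∨ (x 0) (y 0)
count-∨ x y (suc N) = begin
  count (λ n → x n ∨ y n) N + bit (x (suc N) ∨ y (suc N))
    ≤⟨ +-mono-≤ (count-∨ x y N) (bit-∨ (x (suc N)) (y (suc N))) ⟩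
  (count x N + count y N) + (bit (x (suc N)) + bit (y (suc N)))
    ≡⟨ interchange (count x N) (count y N) _ _ ⟩
  count x (suc N) + count y (suc N) ∎
  where open ≤-Reasoning

count-t· : ∀ x N → count (t· x) N ≤ count x N
count-t· x N = ≤-trans (count-≤-count-suc (t· x) N) (≤-reflexive (count-suc (t· x) N))

count-∘suc : ∀ x N → count (x ∘ suc) N ≤ count x N + 1
count-∘suc x N = begin
  count (x ∘ suc) N                 ≤⟨ m≤n+m _ (bit (x 0)) ⟩
  bit (x 0) + count (x ∘ suc) N     ≡⟨ count-suc x N ⟨
  count x N + bit (x (suc N))       ≤⟨ +-monoʳ-≤ (count x N) (bit≤1 (x (suc N))) ⟩
  count x N + 1                     ∎
  where open ≤-Reasoning

count-≤-count-∘suc : ∀ x N → count x N ≤ count (x ∘ suc) N + 1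
count-≤-count-∘suc x N = begin
  count x N                         ≤⟨ count-≤-count-suc x N ⟩
  count x (suc N)                   ≡⟨ count-suc x N ⟩
  bit (x 0) + count (x ∘ suc) N     ≤⟨ +-monoˡ-≤ _ (bit≤1 (x 0)) ⟩
  1 + count (x ∘ suc) N             ≡⟨ +-comm 1 _ ⟩
  count (x ∘ suc) N + 1             ∎
  where open ≤-Reasoning

-- Closure properties of sparse series

Sparse-count-≤ : ∀ c → (∀ N → count x N ≤ count y N + c) → Sparse y → Sparse x
Sparse-count-≤ {x} {y} c h (r , C , hy) = r , C + c , λ N →
  let L = suc ⌊log₂ N ⌋ in begin
  count x N             ≤⟨ h N ⟩
  count y N + c         ≤⟨ +-mono-≤ (hy N) (m≤m*n c (L ^ r) {{m^n≢0 L r}}) ⟩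
  C * L ^ r + c * L ^ r ≡⟨ *-distribʳ-+ (L ^ r) C c ⟨
  (C + c) * L ^ r       ∎
  where open ≤-Reasoning

Sparse-⊆ : x ⊆ y → Sparse y → Sparse x
Sparse-⊆ {x} {y} h = Sparse-count-≤ 0 λ N →
  ≤-trans (count-⊆ h N) (≤-reflexive (sym (+-identityʳ (count y N))))

Sparse-resp : x ≗ y → Sparse x → Sparse y
Sparse-resp e = Sparse-⊆ (λ n p → trans (e n) p)

Sparse-t· : Sparse σ → Sparse (t· σ)
Sparse-t· {σ} = Sparse-count-≤ 0 λ N →
  ≤-trans (count-t· σ N) (≤-reflexive (sym (+-identityʳ (count σ N))))

Sparse-∘suc : Sparse σ → Sparse (σ ∘ suc)
Sparse-∘suc {σ} = Sparse-count-≤ 1 (count-∘suc σ)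

Sparse-∘suc⁻¹ : Sparse (σ ∘ suc) → Sparse σ
Sparse-∘suc⁻¹ {σ} = Sparse-count-≤ 1 (count-≤-count-∘suc σ)

Sparse-drop : ∀ j → Sparse σ → Sparse (λ n → σ (j + n))
Sparse-drop zero    s = s
Sparse-drop (suc j) s = Sparse-drop j (Sparse-∘suc s)

Sparse-undrop : ∀ j → Sparse (λ n → σ (j + n)) → Sparse σ
Sparse-undrop zero    s = s
Sparse-undrop (suc j) s = Sparse-∘suc⁻¹ (Sparse-undrop j s)

Sparse-beyond : ∀ j → (∀ n → x (j + n) ≡ true → y (j + n) ≡ true) → Sparse y → Sparse x
Sparse-beyond j h sy = Sparse-undrop j (Sparse-⊆ h (Sparse-drop j sy))

Sparse-∨ : Sparse x → Sparse y → Sparse (λ n → x n ∨ y n)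
Sparse-∨ {x} {y} (r₁ , C₁ , h₁) (r₂ , C₂ , h₂) = r₁ + r₂ , C₁ + C₂ , λ N →
  let L = suc ⌊log₂ N ⌋ ; r = r₁ + r₂ in begin
  count (λ n → x n ∨ y n) N  ≤⟨ count-∨ x y N ⟩
  count x N + count y N      ≤⟨ +-mono-≤ (h₁ N) (h₂ N) ⟩
  C₁ * L ^ r₁ + C₂ * L ^ r₂  ≤⟨ +-mono-≤ (*-monoʳ-≤ C₁ (^-monoʳ-≤ L (m≤m+n r₁ r₂)))
                                          (*-monoʳ-≤ C₂ (^-monoʳ-≤ L (m≤n+m r₂ r₁))) ⟩
  C₁ * L ^ r + C₂ * L ^ r    ≡⟨ *-distribʳ-+ (L ^ r) C₁ C₂ ⟨
  (C₁ + C₂) * L ^ r          ∎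
  where open ≤-Reasoning

Sparse-xor : Sparse x → Sparse y → Sparse (λ n → x n xor y n)
Sparse-xor {x} {y} sx sy = Sparse-⊆ (λ n → xor⇒∨ (x n) (y n)) (Sparse-∨ sx sy)
  where
  xor⇒∨ : ∀ a b → a xor b ≡ true → a ∨ b ≡ true
  xor⇒∨ true  b _ = refl
  xor⇒∨ false b e = e

∷-· : ∀ b p σ n → ((b ∷ p) · σ) n ≡ (b ∧ σ n) xor (t· (p · σ)) n
∷-· b p σ zero    = sym (xor-identityʳ (b ∧ σ 0))
∷-· b p σ (suc n) = refl

·-t· : ∀ p σ → p · (t· σ) ≗ t· (p · σ)
·-t· []      σ zero    = refl
·-t· []      σ (suc n) = refl
·-t· (b ∷ p) σ zero    = ∧-zeroʳ b
·-t· (b ∷ p) σ (suc n) = trans (cong ((b ∧ σ n) xor_) (·-t· p σ n)) (sym (∷-· b p σ n))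

Sparse-· : ∀ p → Sparse τ → Sparse (p · τ)
Sparse-· []      sτ = Sparse-⊆ (λ _ ()) sτ
Sparse-· {τ} (b ∷ p) sτ = Sparse-resp (λ n → sym (∷-· b p τ n))
  (Sparse-xor (Sparse-⊆ (λ n → ∧-true b (τ n)) sτ) (Sparse-t· (Sparse-· p sτ)))
  where
  ∧-true : ∀ a c → a ∧ c ≡ true → c ≡ true
  ∧-true true c e = e

t^_·_ : ℕ → Series → Series
t^ zero  · σ = σ
t^ suc k · σ = t· (t^ k · σ)

t^-·-if : ∀ k σ n → (t^ k · σ) n ≡ (if k ≤ᵇ n then σ (n ∸ k) else false)
t^-·-if zero          σ n       = refl
t^-·-if (suc k)       σ zero    = refl
t^-·-if (suc zero)    σ (suc n) = refl
t^-·-if (suc (suc k)) σ (suc n) = t^-·-if (suc k) σ n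

t^-·-+ : ∀ k σ n → (t^ k · σ) (k + n) ≡ σ n
t^-·-+ zero    σ n = refl
t^-·-+ (suc k) σ n = t^-·-+ k σ n

Sparse-t^ : ∀ k → Sparse σ → Sparse (t^ k · σ)
Sparse-t^ zero    s = s
Sparse-t^ (suc k) s = Sparse-t· (Sparse-t^ k s)

monomial : ℕ → Poly
monomial k = replicate k false ++ true ∷ []

monomial-· : ∀ k σ → monomial k · σ ≗ t^ k · σ
monomial-· zero    σ zero    = refl
monomial-· zero    σ (suc n) = xor-identityʳ (σ (suc n))
monomial-· (suc k) σ zero    = refl
monomial-· (suc k) σ (suc n) = monomial-· k σ n

tm+1·-≗ : ∀ m σ n → tm+1· m σ n ≡ σ n xor (t^ m · σ) n
tm+1·-≗ m σ n = cong (σ n xor_) (sym (t^-·-if m σ n))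

tm+1·-+ : ∀ m σ n → tm+1· m σ (m + n) ≡ σ (m + n) xor σ n
tm+1·-+ m σ n = trans (tm+1·-≗ m σ (m + n)) (cong (σ (m + n) xor_) (t^-·-+ m σ n))

-- Supports within bounded distance of a sparse support

Gap : Series → ℕ → ℕ → Set
Gap y n j = ∀ i → i < j → y (suc i + n) ≡ false

Gap-shorten : ∀ {y n i j} → i ≤ j → Gap y n j → Gap y n i
Gap-shorten i≤j gap k k<i = gap k (<-≤-trans k<i i≤j)

spread : ℕ → Series → Series
spread zero    y n = false
spread (suc j) y n = y n ∨ (t· spread j y) n

Sparse-spread : ∀ j → Sparse y → Sparse (spread j y)
Sparse-spread zero    sy = Sparse-⊆ (λ _ ()) sy
Sparse-spread (suc j) sy = Sparse-∨ sy (Sparse-t· (Sparse-spread j sy))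

spread≡false⇒Gap : ∀ j y n → spread j y (j + n) ≡ false → Gap y n j
spread≡false⇒Gap zero    y n _ i ()
spread≡false⇒Gap (suc j) y n e i (s≤s i≤j)
  with top , rest ← ∨≡false⇒ (y (suc (j + n))) (spread j y (j + n)) e
  with m≤n⇒m<n∨m≡n i≤j
... | inj₁ i<j  = spread≡false⇒Gap j y n rest i i<j
... | inj₂ refl = top

Sparse-near : ∀ j → (∀ n → x (j + n) ≡ true → ¬ Gap y n j) → Sparse y → Sparse x
Sparse-near {x} {y} j h sy = Sparse-beyond j near (Sparse-spread j sy)
  where
  near : ∀ n → x (j + n) ≡ true → spread j y (j + n) ≡ true
  near n e with spread j y (j + n) in eq
  ... | true  = refl
  ... | false = ⊥-elim (h n e (spread≡false⇒Gap j y n eq))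

-- Windows and linear recurrences

-- window d σ n = (σ n, σ (n - 1), …, σ (n - d + 1)), with zeros at negative indices.
window : (d : ℕ) → Series → ℕ → Vec Bool d
window zero    σ n = []
window (suc d) σ n = σ n ∷ window d (t· σ) n

push : ∀ {d} → Bool → Vec Bool d → Vec Bool d
push b []      = []
push b (c ∷ w) = b ∷ push c w

window-suc : ∀ d σ n → window d σ (suc n) ≡ push (σ (suc n)) (window d σ n)
window-suc zero    σ n = refl
window-suc (suc d) σ n = cong (σ (suc n) ∷_) (window-suc d (t· σ) n)

convolve : ∀ {d} → Poly → Vec Bool d → Bool
convolve []      w       = false
convolve (b ∷ p) []      = false
convolve (b ∷ p) (c ∷ w) = (b ∧ c) xor convolve p w

·-window : ∀ p {d} → length p ≤ d → ∀ σ n → (p · σ) n ≡ convolve p (window d σ n)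
·-window []      _          σ n = refl
·-window (b ∷ p) (s≤s p≤d) σ n = begin
  ((b ∷ p) · σ) n                                ≡⟨ ∷-· b p σ n ⟩
  (b ∧ σ n) xor (t· (p · σ)) n                   ≡⟨ cong ((b ∧ σ n) xor_) (·-t· p σ n) ⟨
  (b ∧ σ n) xor (p · t· σ) n                     ≡⟨ cong ((b ∧ σ n) xor_) (·-window p p≤d (t· σ) n) ⟩
  (b ∧ σ n) xor convolve p (window _ (t· σ) n)   ∎
  where open ≡-Reasoning

module UnitConstantTerm (q : Poly) (σ : Series) (sρ : Sparse ((true ∷ q) · σ)) where

  ρ : Series
  ρ = (true ∷ q) · σ

  -- One entry more than convolve q needs, so that the window is never empty.
  d : ℕ
  d = suc (length q)

  step : Vec Bool d → Vec Bool d
  step w = push (convolve q w) w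

  window-step : ∀ n → ρ (suc n) ≡ false → window d σ (suc n) ≡ step (window d σ n)
  window-step n e = begin
    window d σ (suc n)                    ≡⟨ window-suc d σ n ⟩
    push (σ (suc n)) (window d σ n)       ≡⟨ cong (λ b → push b (window d σ n)) recurrence ⟩
    step (window d σ n)                   ∎
    where
    open ≡-Reasoning
    recurrence : σ (suc n) ≡ convolve q (window d σ n)
    recurrence = trans (xor≡false⇒≡ (σ (suc n)) _ e) (·-window q (n≤1+n _) σ n)

  window-fold : ∀ n j → Gap ρ n j → window d σ (j + n) ≡ fold (window d σ n) step j
  window-fold n zero    gap = refl
  window-fold n (suc j) gap =
    trans (window-step (j + n) (gap j ≤-refl))
          (cong step (window-fold n j (Gap-shorten {ρ} (n≤1+n j) gap)))

  windows : ∃₂ λ a b → a < b × ∀ w → fold w step a ≡ fold w step b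
  windows = fold-collision (vectors (false ∷ true ∷ []) d) (∈-vectors ∈-bools) step

  a b period : ℕ
  a = proj₁ windows
  b = proj₁ (proj₂ windows)
  period = b ∸ a

  a<b : a < b
  a<b = proj₁ (proj₂ (proj₂ windows))

  σ-repeats-across-Gap : ∀ n → Gap ρ n b → σ (b + n) ≡ σ (a + n)
  σ-repeats-across-Gap n gap = cong head (begin
    window d σ (b + n)           ≡⟨ window-fold n b gap ⟩
    fold (window d σ n) step b   ≡⟨ proj₂ (proj₂ (proj₂ windows)) (window d σ n) ⟨
    fold (window d σ n) step a   ≡⟨ window-fold n a (Gap-shorten {ρ} (<⇒≤ a<b) gap) ⟨
    window d σ (a + n)           ∎)
    where open ≡-Reasoning

  tm+1·-vanishes-after-Gap : ∀ n → Gap ρ n b → tm+1· period σ (b + n) ≡ false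
  tm+1·-vanishes-after-Gap n gap = begin
    tm+1· period σ (b + n)              ≡⟨ cong (tm+1· period σ) period+a+n≡b+n ⟨
    tm+1· period σ (period + (a + n))   ≡⟨ tm+1·-+ period σ (a + n) ⟩
    σ (period + (a + n)) xor σ (a + n)  ≡⟨ cong (λ k → σ k xor σ (a + n)) period+a+n≡b+n ⟩
    σ (b + n) xor σ (a + n)             ≡⟨ cong (_xor σ (a + n)) (σ-repeats-across-Gap n gap) ⟩
    σ (a + n) xor σ (a + n)             ≡⟨ xor-same (σ (a + n)) ⟩
    false                               ∎
    where
    open ≡-Reasoning
    period+a+n≡b+n : period + (a + n) ≡ b + n
    period+a+n≡b+n = trans (sym (+-assoc period a n)) (cong (_+ n) (m∸n+n≡m (<⇒≤ a<b)))

  Sparse-tm+1· : Σ ℕ λ m → m ≥ 1 × Sparse (tm+1· m σ)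
  Sparse-tm+1· = period , m<n⇒0<n∸m a<b , Sparse-near b gap-free sρ
    where
    gap-free : ∀ n → tm+1· period σ (b + n) ≡ true → ¬ Gap ρ n b
    gap-free n e gap with () ← trans (sym e) (tm+1·-vanishes-after-Gap n gap)

Sparse-·-unitConstantTerm : ∀ q → NonZeroPoly q → Sparse (q · σ) →
                            Σ Poly λ q′ → Sparse ((true ∷ q′) · σ)
Sparse-·-unitConstantTerm (b     ∷ q) (here refl) s = q , s
Sparse-·-unitConstantTerm (true  ∷ q) (there _)   s = q , s
Sparse-·-unitConstantTerm (false ∷ q) (there q≢0) s =
  Sparse-·-unitConstantTerm q q≢0 (Sparse-∘suc s)

InSHat⇒Sparse-tm+1· : InSHat σ → Σ ℕ λ m → m ≥ 1 × Sparse (tm+1· m σ)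
InSHat⇒Sparse-tm+1· {σ} (τ , p , q , sτ , q≢0 , q·σ≗p·τ)
  with q′ , s ← Sparse-·-unitConstantTerm q q≢0 (Sparse-resp (sym ∘ q·σ≗p·τ) (Sparse-· p sτ))
  = UnitConstantTerm.Sparse-tm+1· q′ σ s

Sparse-tm+1·⇒InSHat : Σ ℕ (λ m → m ≥ 1 × Sparse (tm+1· m σ)) → InSHat σ
Sparse-tm+1·⇒InSHat {σ} (suc k , _ , s) =
  tm+1· (suc k) σ , true ∷ [] , true ∷ monomial k , s , here refl , λ n → begin
    ((true ∷ monomial k) · σ) n           ≡⟨ ∷-· true (monomial k) σ n ⟩
    σ n xor (t· (monomial k · σ)) n       ≡⟨ cong (σ n xor_) (t·-cong (monomial-· k σ) n) ⟩
    σ n xor (t^ suc k · σ) n              ≡⟨ tm+1·-≗ (suc k) σ n ⟨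
    tm+1· (suc k) σ n                     ≡⟨ monomial-· 0 (tm+1· (suc k) σ) n ⟨
    ((true ∷ []) · tm+1· (suc k) σ) n     ∎
  where open ≡-Reasoning

diffSeries≗tm+1·-drop : ∀ m σ n → diffSeries m σ n ≡ tm+1· m σ (m + n)
diffSeries≗tm+1·-drop m σ n = begin
  σ n xor σ (n + m)   ≡⟨ cong (λ k → σ n xor σ k) (+-comm n m) ⟩
  σ n xor σ (m + n)   ≡⟨ xor-comm (σ n) (σ (m + n)) ⟩
  σ (m + n) xor σ n   ≡⟨ tm+1·-+ m σ n ⟨
  tm+1· m σ (m + n)   ∎
  where open ≡-Reasoning

Sparse-tm+1·⇔Sparse-diffSeries : ∀ m σ → Sparse (tm+1· m σ) ⇔ Sparse (diffSeries m σ)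
Sparse-tm+1·⇔Sparse-diffSeries m σ = mk⇔
  (λ s → Sparse-resp (sym ∘ diffSeries≗tm+1·-drop m σ) (Sparse-drop m s))
  (λ s → Sparse-beyond m (λ n → trans (shifted n)) (Sparse-t^ m s))
  where
  shifted : ∀ n → (t^ m · diffSeries m σ) (m + n) ≡ tm+1· m σ (m + n)
  shifted n = trans (t^-·-+ m (diffSeries m σ) n) (diffSeries≗tm+1·-drop m σ n)

diffSeries-double : ∀ m σ n → diffSeries (2 * m) σ n ≡ diffSeries m σ n xor diffSeries m σ (m + n)
diffSeries-double m σ n = begin
  σ n xor σ (n + 2 * m)                          ≡⟨ cong (λ k → σ n xor σ k) n+2m≡ ⟩
  σ n xor σ (m + n + m)                          ≡⟨ xor-telescope (σ n) (σ (m + n)) (σ (m + n + m)) ⟩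
  (σ n xor σ (m + n)) xor diffSeries m σ (m + n) ≡⟨ cong (λ k → (σ n xor σ k) xor diffSeries m σ (m + n)) (+-comm m n) ⟩
  diffSeries m σ n xor diffSeries m σ (m + n)    ∎
  where
  open ≡-Reasoning
  n+2m≡ : n + 2 * m ≡ m + n + m
  n+2m≡ = begin
    n + (m + (m + 0)) ≡⟨ cong (λ k → n + (m + k)) (+-identityʳ m) ⟩
    n + (m + m)       ≡⟨ +-assoc n m m ⟨
    n + m + m         ≡⟨ cong (_+ m) (+-comm n m) ⟩
    m + n + m         ∎

Sparse-diffSeries-double : ∀ m σ → Sparse (diffSeries m σ) → Sparse (diffSeries (2 * m) σ)
Sparse-diffSeries-double m σ s =
  Sparse-resp (sym ∘ diffSeries-double m σ) (Sparse-xor s (Sparse-drop m s))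

Sparse-diffSeries⇔Sparse-diffSeries-2^ : ∀ m σ →
  Sparse (diffSeries m σ) ⇔ ((q : ℕ) → Sparse (diffSeries (2 ^ q * m) σ))
Sparse-diffSeries⇔Sparse-diffSeries-2^ m σ = mk⇔ all-powers
  (λ s → subst (Sparse ∘ (λ k → diffSeries k σ)) (*-identityˡ m) (s 0))
  where
  all-powers : Sparse (diffSeries m σ) → (q : ℕ) → Sparse (diffSeries (2 ^ q * m) σ)
  all-powers s zero    = subst (Sparse ∘ (λ k → diffSeries k σ)) (sym (*-identityˡ m)) s
  all-powers s (suc q) = subst (Sparse ∘ (λ k → diffSeries k σ)) (sym (*-assoc 2 (2 ^ q) m))
    (Sparse-diffSeries-double (2 ^ q * m) σ (all-powers s q))

∃-positive-⇔ : {P Q : ℕ → Set} → (∀ m → P m ⇔ Q m) →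
               Σ ℕ (λ m → m ≥ 1 × P m) ⇔ Σ ℕ (λ m → m ≥ 1 × Q m)
∃-positive-⇔ P⇔Q = mk⇔
  (λ (m , m≥1 , p) → m , m≥1 , Equivalence.to   (P⇔Q m) p)
  (λ (m , m≥1 , q) → m , m≥1 , Equivalence.from (P⇔Q m) q)

proposition10p13 : (σ : Series) →
    (InSHat σ ⇔ Σ ℕ (λ m → m ≥ 1 × Sparse (tm+1· m σ)))
    × (InSHat σ ⇔ Σ ℕ (λ m → m ≥ 1 × Sparse (diffSeries m σ)))
    × (InSHat σ ⇔ Σ ℕ (λ m → m ≥ 1 × ((q : ℕ) → Sparse (diffSeries (2 ^ q * m) σ))))
proposition10p13 σ = one⇔two , one⇔three , one⇔four
  where
  one⇔two = mk⇔ InSHat⇒Sparse-tm+1· Sparse-tm+1·⇒InSHat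
  one⇔three = ∃-positive-⇔ (λ m → Sparse-tm+1·⇔Sparse-diffSeries m σ) ⇔-∘ one⇔two
  one⇔four = ∃-positive-⇔ (λ m → Sparse-diffSeries⇔Sparse-diffSeries-2^ m σ) ⇔-∘ one⇔three
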